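{- If $\mathcal{T}$ is a single-elimination tournament with at least $2$ players and $N$ brackets in total, and $\sigma$ is a scoring system on $\mathcal{T}$ with distinct subset sums, then $\mathrm{res}(\mathcal{T},\sigma)=(1-q_{\mathrm{pair}})N+1$, where $q_{\mathrm{pair}}=\min_{a,b\in P(\mathcal{T}),\,a\ne b}\Pr[R(x_{a,b})\in\{a,b\}]$ for $R$ a uniformly random bracket of $\mathcal{T}$.
   Context: For a digraph, $N^+(v)$ is the set of out-neighbours of $v$ and $N^-(v)$ the set of in-neighbours; a sink has $N^+(v)=\emptyset$, a source has $N^-(v)=\emptyset$. A single-elimination tournament $\mathcal{T}$ is a finite digraph with: exactly one sink; $|N^+(v)|=1$ for every non-sink $v$; no directed cycles; and $|N^-(v)|\ne 1$ for every vertex $v$. Players $P(\mathcal{T})$ are the sources; matches $M(\mathcal{T})$ are the non-sources. A directed walk from $u_1$ to $u_t$ is a sequence $(u_1,\dots,u_t)$, $t\ge1$, with $u_{i+1}\in N^+(u_i)$; the player set $P(u)$ of a vertex $u$ is the set of players $a$ with a directed walk from $a$ to $u$. For distinct players $a,b$, $x_{a,b}$ denotes the unique match $x$ having in-neighbours $u_a,u_b\in N^-(x)$ with $P(u_a)\cap\{a,b\}=\{a\}$ and $P(u_b)\cap\{a,b\}=\{b\}$ (such a match exists and is unique). A bracket is a function $B:V(\mathcal{T})\to P(\mathcal{T})$ with $B(a)=a$ for every player $a$ and $B(x)\in\{B(u):u\in N^-(x)\}$ for every match $x$. A scoring system is a function $\sigma:M(\mathcal{T})\to\mathbb{R}_{>0}$;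 it has distinct subset sums if for any two sets of matches $M,M'$, $\sum_{x\in M}\sigma(x)=\sum_{x\in M'}\sigma(x)$ implies $M=M'$. $\mathrm{score}_\sigma(B,B')=\sum_{x\in M(\mathcal{T}):B(x)=B'(x)}\sigma(x)$. A set of brackets $\mathcal{B}$ is $\sigma$-resolving if for all pairs of distinct brackets $B,B'$ there is $B_i\in\mathcal{B}$ with $\mathrm{score}_\sigma(B_i,B)\ne\mathrm{score}_\sigma(B_i,B')$. $\mathrm{res}(\mathcal{T},\sigma)$ is the minimum $r$ such that every set of $r$ brackets of $\mathcal{T}$ is $\sigma$-resolving. -}

module Defs where

open import Level using (0ℓ)
open import Data.Bool using (Bool; true; false; if_then_else_; _∧_)
open import Data.Nat using (ℕ; _≤_)
open import Data.Fin using (Fin)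
open import Data.Fin.Properties using (all?; _≟_)
open import Data.Product using (Σ; _×_; ∃; _,_)
open import Data.Sum using (_⊎_)
open import Relation.Nullary using (¬_; Dec; yes; no)
open import Relation.Nullary.Decidable using (isYes; ¬?)
open import Relation.Binary.PropositionalEquality using (_≡_; _≢_)
open import Algebra.Bundles using (CommutativeMonoid)
import Algebra.Properties.CommutativeMonoid.Sum as SumProps

-- A finite (simple) digraph on vertex set Fin n:
-- E u v ≡ true  iff  v ∈ N⁺(u)  (equivalently u ∈ N⁻(v)).
Digraph : ℕ → Set
Digraph n = Fin n → Fin n → Bool

module _ {n : ℕ} (E : Digraph n) where

  IsSink : Fin n → Set
  IsSink v = ∀ w → E v w ≡ false

  IsSource : Fin n → Set
  IsSource v = ∀ u → E u v ≡ false

  source? : (v : Fin n) → Dec (IsSource v)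
  source? v = all? (λ u → Data.Bool._≟_ (E u v) false)

  IsPlayer : Fin n → Set
  IsPlayer = IsSource

  IsMatch : Fin n → Set
  IsMatch v = ¬ IsSource v

  matchB : Fin n → Bool
  matchB v = isYes (¬? (source? v))

  data Walk : Fin n → Fin n → Set where
    here : ∀ {u} → Walk u u
    step : ∀ {u w v} → E u w ≡ true → Walk w v → Walk u v

  InP : Fin n → Fin n → Set
  InP a u = IsPlayer a × Walk a u

  record IsSET : Set where
    field
      uniqueSink  : Σ (Fin n) λ s → IsSink s × (∀ v → IsSink v → v ≡ s)
      oneOut      : ∀ v → ¬ IsSink v →
                      Σ (Fin n) λ w → E v w ≡ true × (∀ w' → E v w' ≡ true → w' ≡ w)
      acyclic     : ∀ u v → E u v ≡ true → ¬ Walk v u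
      inDegNotOne : ∀ v → ¬ (Σ (Fin n) λ u → E u v ≡ true × (∀ u' → E u' v ≡ true → u' ≡ u))

  IsXab : Fin n → Fin n → Fin n → Set
  IsXab x a b = IsMatch x × Σ (Fin n) λ ua → Σ (Fin n) λ ub →
    E ua x ≡ true × E ub x ≡ true ×
    InP a ua × ¬ InP b ua × InP b ub × ¬ InP a ub

  record IsBracket (B : Fin n → Fin n) : Set where
    field
      toPlayer : ∀ v → IsPlayer (B v)
      onPlayer : ∀ a → IsPlayer a → B a ≡ a
      onMatch  : ∀ x → IsMatch x → Σ (Fin n) λ u → E u x ≡ true × B x ≡ B u

  Distinct : (Fin n → Fin n) → (Fin n → Fin n) → Set
  Distinct B B' = ¬ (∀ v → B v ≡ B' v)

  -- "exactly k functions Fin n → Fin n satisfy Q" (counted up to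
  -- pointwise equality): an injective enumeration of all of them by Fin k.
  HasCount : ((Fin n → Fin n) → Set) → ℕ → Set
  HasCount Q k = Σ (Fin k → (Fin n → Fin n)) λ f →
    (∀ i → Q (f i)) ×
    (∀ i j → i ≢ j → Distinct (f i) (f j)) ×
    (∀ B → Q B → Σ (Fin k) λ i → ∀ v → f i v ≡ B v)

  PairCount : Fin n → Fin n → Fin n → ℕ → Set
  PairCount x a b c = HasCount (λ B → IsBracket B × (B x ≡ a ⊎ B x ≡ b)) c

  -- m = min over distinct players a,b of #{B : B(x_{a,b}) ∈ {a,b}}
  -- (i.e. m = q_pair · N)
  IsMinPairCount : ℕ → Set
  IsMinPairCount m =
    (Σ (Fin n) λ a → Σ (Fin n) λ b → Σ (Fin n) λ x →
       IsPlayer a × IsPlayer b × a ≢ b × IsXab x a b × PairCount x a b m)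
    × (∀ a b x c → IsPlayer a → IsPlayer b → a ≢ b → IsXab x a b →
         PairCount x a b c → m ≤ c)

  module Scoring (M : CommutativeMonoid 0ℓ 0ℓ) where
    open CommutativeMonoid M
    open SumProps M using (sum)

    sumOver : (Fin n → Carrier) → (Fin n → Bool) → Carrier
    sumOver σ S = sum (λ v → if S v then σ v else ε)

    DistinctSubsetSums : (Fin n → Carrier) → Set
    DistinctSubsetSums σ = ∀ (S S' : Fin n → Bool) →
      (∀ v → S v ≡ true → IsMatch v) → (∀ v → S' v ≡ true → IsMatch v) →
      sumOver σ S ≈ sumOver σ S' → ∀ v → S v ≡ S' v

    score : (Fin n → Carrier) → (Fin n → Fin n) → (Fin n → Fin n) → Carrier
    score σ B B' = sumOver σ (λ v → matchB v ∧ isYes (B v ≟ B' v))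

    IsBracketSet : (r : ℕ) → (Fin r → (Fin n → Fin n)) → Set
    IsBracketSet r f = (∀ i → IsBracket (f i)) × (∀ i j → i ≢ j → Distinct (f i) (f j))

    Resolving : (Fin n → Carrier) → (r : ℕ) → (Fin r → (Fin n → Fin n)) → Set
    Resolving σ r f = ∀ B B' → IsBracket B → IsBracket B' → Distinct B B' →
      Σ (Fin r) λ i → ¬ (score σ (f i) B ≈ score σ (f i) B')

    AllResolving : (Fin n → Carrier) → ℕ → Set
    AllResolving σ r = ∀ f → IsBracketSet r f → Resolving σ r f

    IsRes : (Fin n → Carrier) → ℕ → Set
    IsRes σ r = AllResolving σ r × (∀ r' → AllResolving σ r' → r ≤ r')

-- Upper bound: if distinct brackets B, B′ get equal scores against every member F of a
-- family, distinct subset sums force F to agree with B and with B′ on the same matches.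
-- At a lowest match x where B and B′ differ, x = x_{a,b} for a = B x and b = B′ x, and
-- F x ∉ {a, b}; so the family lies among the N − c brackets avoiding {a, b} at x, with c ≥ m.
--
-- Lower bound: for a pair a, b attaining m there are brackets B, B′ differing only at
-- x = x_{a,b}.  Let the better seed always win, seeding first a player c from the subtree
-- of the sibling of x, then a, then b: c then wins the match after x whoever wins x.
-- The N − m brackets avoiding {a, b} at x cannot tell B from B′.

{-# OPTIONS --safe #-}
module Submission where

open import Defs
open import Level using (0ℓ; _⊔_)
open import Data.Nat using (ℕ; _+_; _∸_)
open import Data.Fin using (Fin)
open import Data.Product using (Σ; _×_)
open import Relation.Binary.PropositionalEquality using (_≢_)
open import Algebra.Bundles using (CommutativeMonoid)

open import Data.Bool using (Bool; true; false; _∧_; if_then_else_)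
import Data.Bool as Bool
open import Data.Bool.Properties using (∧-conicalˡ; ∧-conicalʳ; ∧-zeroʳ; ¬-not; not-¬)
open import Data.Nat using (zero; suc; z≤n; s≤s; _≤_; _<_; _≤?_; _<?_)
open import Data.Nat.Induction using (<-wellFounded)
open import Data.Nat.Properties
  using ( ≮⇒≥; ≰⇒>; ≤-pred; <-irrefl; ≤-antisym; ≤-trans; ≤-reflexive; 0≢1+n; suc-injective
        ; +-suc; +-assoc; +-comm; m+n∸m≡n; ∸-monoʳ-≤)
open import Data.Fin using (zero; suc; toℕ; inject≤; _≟_)
open import Data.Fin.Properties as Finₚ
  using (any?; all?; ¬∀⟶∃¬; toℕ-injective; inject≤-injective; injective⇒≤)
open import Data.Fin.Induction using (spo-wellFounded; spo-noetherian)
open import Data.Product using (∃; ∃₂; _,_; proj₁; proj₂)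
open import Data.Sum using (_⊎_; inj₁; inj₂; [_,_]′)
open import Data.Unit using (⊤; tt)
open import Data.Vec.Functional using (updateAt)
open import Data.Vec.Functional.Properties using (updateAt-updates; updateAt-minimal)
open import Function using (_∘_; const; flip)
open import Function.Definitions using (Injective)
open import Induction.WellFounded using (Acc; acc; WellFounded; module Subrelation)
open import Relation.Binary using (Rel; IsStrictPartialOrder; Decidable)
open import Relation.Binary.PropositionalEquality
  using (_≡_; refl; sym; trans; cong; cong₂; subst; resp₂; isEquivalence; _≗_; module ≡-Reasoning)
open import Relation.Nullary using (¬_; Dec; yes; no; contradiction)
open import Relation.Nullary.Decidable
  using (isYes; ¬?; map′; _×-dec_; _⊎-dec_; decidable-stable; isYes≗does; dec-true; dec-false)
open import Relation.Unary using (Pred; ∁) renaming (Decidable to Decidable₁)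
import Algebra.Properties.CommutativeMonoid.Sum as SumProps

Least : ∀ {a ℓ} {A : Set a} → (A → ℕ) → Pred A ℓ → Pred A (a ⊔ ℓ)
Least κ S c = S c × (∀ {d} → S d → κ c ≤ κ d)

∃-least : ∀ {m ℓ} {S : Pred (Fin m) ℓ} (κ : Fin m → ℕ) → Decidable₁ S → ∃ S → ∃ (Least κ S)
∃-least {S = S} κ S? (c , c∈S) = go c c∈S (<-wellFounded (κ c))
  where
  go : ∀ c → S c → Acc _<_ (κ c) → ∃ (Least κ S)
  go c c∈S (acc rs) with any? (λ d → S? d ×-dec κ d <? κ c)
  ... | yes (d , d∈S , d<c) = go d d∈S (rs d<c)
  ... | no ¬smaller = c , c∈S , λ d∈S → ≮⇒≥ (λ d<c → ¬smaller (_ , d∈S , d<c))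

Least-unique : ∀ {a ℓ} {A : Set a} {κ : A → ℕ} {S : Pred A ℓ} → Injective _≡_ _≡_ κ →
               ∀ {c d} → Least κ S c → Least κ S d → c ≡ d
Least-unique κ-injective (c∈S , c-least) (d∈S , d-least) =
  κ-injective (≤-antisym (c-least d∈S) (d-least c∈S))

record Enumeration {N : ℕ} {p} (P : Pred (Fin N) p) (k : ℕ) : Set p where
  field
    index           : Fin k → Fin N
    index-∈         : ∀ i → P (index i)
    index-injective : Injective _≡_ _≡_ index
    index-onto      : ∀ {j} → P j → ∃ λ i → index i ≡ j

module _ {N p} {P : Pred (Fin (suc N)) p} {k : ℕ} (e : Enumeration (P ∘ suc) k) where
  open Enumeration e

  Enumeration-cons : P zero → Enumeration P (suc k)
  Enumeration-cons P₀ = record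
    { index = index′ ; index-∈ = index′-∈ ; index-injective = index′-injective ; index-onto = index′-onto }
    where
    index′ : Fin (suc k) → Fin (suc N)
    index′ zero    = zero
    index′ (suc i) = suc (index i)

    index′-∈ : ∀ i → P (index′ i)
    index′-∈ zero    = P₀
    index′-∈ (suc i) = index-∈ i

    index′-injective : Injective _≡_ _≡_ index′
    index′-injective {zero}  {zero}  _  = refl
    index′-injective {suc i} {suc j} eq = cong suc (index-injective (Finₚ.suc-injective eq))
    index′-injective {zero}  {suc _} ()
    index′-injective {suc _} {zero}  ()

    index′-onto : ∀ {j} → P j → ∃ λ i → index′ i ≡ j
    index′-onto {zero}  _  = zero , refl
    index′-onto {suc j} Pj with index-onto Pj
    ... | i , refl = suc i , refl

  Enumeration-skip : ¬ P zero → Enumeration P k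
  Enumeration-skip ¬P₀ = record
    { index = suc ∘ index ; index-∈ = index-∈
    ; index-injective = index-injective ∘ Finₚ.suc-injective ; index-onto = index′-onto }
    where
    index′-onto : ∀ {j} → P j → ∃ λ i → suc (index i) ≡ j
    index′-onto {zero}  P₀ = contradiction P₀ ¬P₀
    index′-onto {suc j} Pj with index-onto Pj
    ... | i , refl = i , refl

Enumeration-empty : ∀ {p} {P : Pred (Fin 0) p} → Enumeration P 0
Enumeration-empty = record { index = λ () ; index-∈ = λ () ; index-injective = λ {} ; index-onto = λ {} }

partition : ∀ {N p} {P : Pred (Fin N) p} → Decidable₁ P →
            ∃₂ λ k k′ → k + k′ ≡ N × Enumeration P k × Enumeration (∁ P) k′
partition {zero}  P? = 0 , 0 , refl , Enumeration-empty , Enumeration-empty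
partition {suc N} P? with partition (P? ∘ suc) | P? zero
... | k , k′ , k+k′≡N , e , e′ | yes P₀ =
  suc k , k′ , cong suc k+k′≡N , Enumeration-cons e P₀ , Enumeration-skip e′ (λ ¬P₀ → ¬P₀ P₀)
... | k , k′ , k+k′≡N , e , e′ | no ¬P₀ =
  k , suc k′ , trans (+-suc k k′) (cong suc k+k′≡N) , Enumeration-skip e ¬P₀ , Enumeration-cons e′ ¬P₀

∸-complement : ∀ {c c′ N} → c + c′ ≡ N → N + 1 ∸ c ≡ suc c′
∸-complement {c} {c′} refl = begin
  c + c′ + 1 ∸ c   ≡⟨ cong (_∸ c) (+-assoc c c′ 1) ⟩
  c + (c′ + 1) ∸ c ≡⟨ m+n∸m≡n c (c′ + 1) ⟩
  c′ + 1           ≡⟨ +-comm c′ 1 ⟩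
  suc c′           ∎
  where open ≡-Reasoning

module Counting {n : ℕ} (E : Digraph n) where

  DistinctFamily : ((Fin n → Fin n) → Set) → ℕ → Set
  DistinctFamily Q k =
    Σ (Fin k → (Fin n → Fin n)) λ f → (∀ i → Q (f i)) × (∀ i j → i ≢ j → Distinct E (f i) (f j))

  module _ {Q : (Fin n → Fin n) → Set} where

    count-family : ∀ {k} → HasCount E Q k → DistinctFamily Q k
    count-family (f , Qf , f-distinct , _) = f , Qf , f-distinct

    family-≤-count : ∀ {k k′} → DistinctFamily Q k → HasCount E Q k′ → k ≤ k′
    family-≤-count {k} (f , Qf , f-distinct) (g , _ , _ , g-onto) = injective⇒≤ position-injective
      where
      position : Fin k → Fin _
      position i = proj₁ (g-onto (f i) (Qf i))

      position-injective : Injective _≡_ _≡_ position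
      position-injective {i} {j} eq with i ≟ j
      ... | yes i≡j = i≡j
      ... | no i≢j  = contradiction f-i≗f-j (f-distinct i j i≢j)
        where
        f-i≗f-j : f i ≗ f j
        f-i≗f-j v = trans (sym (proj₂ (g-onto _ (Qf i)) v))
                          (trans (cong (λ p → g p v) eq) (proj₂ (g-onto _ (Qf j)) v))

    count-unique : ∀ {k k′} → HasCount E Q k → HasCount E Q k′ → k ≡ k′
    count-unique c c′ = ≤-antisym (family-≤-count (count-family c) c′) (family-≤-count (count-family c′) c)

    subfamily : ∀ {k r} → DistinctFamily Q k → r ≤ k → DistinctFamily Q r
    subfamily (f , Qf , f-distinct) r≤k =
      (λ i → f (inject≤ i r≤k)) , (λ i → Qf (inject≤ i r≤k)) ,
      (λ i j i≢j → f-distinct _ _ (i≢j ∘ inject≤-injective r≤k r≤k i j))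

    count-restrict : ∀ {R : (Fin n → Fin n) → Set} {N k} (c : HasCount E Q N) →
                     (∀ {B B′} → B ≗ B′ → R B → R B′) → Enumeration (R ∘ proj₁ c) k →
                     HasCount E (λ B → Q B × R B) k
    count-restrict {R} (g , Qg , g-distinct , g-onto) R-resp e =
      g ∘ index , (λ i → Qg (index i) , index-∈ i) , (λ i j i≢j → g-distinct _ _ (i≢j ∘ index-injective)) , onto
      where
      open Enumeration e

      onto : ∀ B → Q B × R B → ∃ λ i → ∀ v → g (index i) v ≡ B v
      onto B (QB , RB) with g-onto B QB
      ... | j , gj≗B with index-onto (R-resp (sym ∘ gj≗B) RB)
      ...   | i , refl = i , gj≗B

    count-split : ∀ {R : (Fin n → Fin n) → Set} {N} → HasCount E Q N → Decidable₁ R →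
                  (∀ {B B′} → B ≗ B′ → R B → R B′) →
                  ∃₂ λ k k′ → k + k′ ≡ N × HasCount E (λ B → Q B × R B) k × HasCount E (λ B → Q B × ¬ R B) k′
    count-split c R? R-resp with partition (R? ∘ proj₁ c)
    ... | k , k′ , k+k′≡N , e , e′ =
      k , k′ , k+k′≡N , count-restrict c R-resp e ,
      count-restrict c (λ B≗B′ ¬RB RB′ → ¬RB (R-resp (sym ∘ B≗B′) RB′)) e′

module Agreement {n : ℕ} (E : Digraph n) (M : CommutativeMonoid 0ℓ 0ℓ) where
  open CommutativeMonoid M using (_≈_; ε; reflexive)
  open Scoring E M
  open SumProps M using (sum-cong-≗)

  agreement : (Fin n → Fin n) → (Fin n → Fin n) → Fin n → Bool
  agreement F B v = matchB E v ∧ isYes (F v ≟ B v)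

  agreement-≗? : ∀ F B B′ → Dec (agreement F B ≗ agreement F B′)
  agreement-≗? F B B′ = all? (λ v → agreement F B v Bool.≟ agreement F B′ v)

  private
    isYes⇒ : ∀ {p} {P : Set p} (P? : Dec P) → isYes P? ≡ true → P
    isYes⇒ (yes p) _ = p

    isYes-true : ∀ {p} {P : Set p} (P? : Dec P) → P → isYes P? ≡ true
    isYes-true P? p = trans (isYes≗does P?) (dec-true P? p)

  module _ {F B : Fin n → Fin n} {v : Fin n} where

    agreement⇒match : agreement F B v ≡ true → IsMatch E v
    agreement⇒match t = isYes⇒ (¬? (source? E v)) (∧-conicalˡ _ _ t)

    agreement⇒≡ : agreement F B v ≡ true → F v ≡ B v
    agreement⇒≡ t = isYes⇒ (F v ≟ B v) (∧-conicalʳ _ _ t)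

    agreement-true : IsMatch E v → F v ≡ B v → agreement F B v ≡ true
    agreement-true v-match eq = cong₂ _∧_ (isYes-true (¬? (source? E v)) v-match) (isYes-true (F v ≟ B v) eq)

    agreement-false : F v ≢ B v → agreement F B v ≡ false
    agreement-false ne =
      trans (cong (matchB E v ∧_) (trans (isYes≗does _) (dec-false (F v ≟ B v) ne))) (∧-zeroʳ (matchB E v))

  module _ {F B B′ : Fin n → Fin n} where

    score-injective : ∀ {σ} → DistinctSubsetSums σ → score σ F B ≈ score σ F B′ → agreement F B ≗ agreement F B′
    score-injective dss = dss _ _ (λ _ → agreement⇒match {F} {B}) (λ _ → agreement⇒match {F} {B′})

    score-cong : ∀ {σ} → agreement F B ≗ agreement F B′ → score σ F B ≈ score σ F B′
    score-cong {σ} same = reflexive (sum-cong-≗ (λ v → cong (λ t → if t then σ v else ε) (same v)))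

    avoids-pair : ∀ {x} → IsMatch E x → B x ≢ B′ x → agreement F B x ≡ agreement F B′ x →
                  ¬ (F x ≡ B x ⊎ F x ≡ B′ x)
    avoids-pair x-match Bx≢B′x same (inj₁ Fx≡Bx) =
      Bx≢B′x (trans (sym Fx≡Bx) (agreement⇒≡ {F} {B′} (trans (sym same) (agreement-true {F} {B} x-match Fx≡Bx))))
    avoids-pair x-match Bx≢B′x same (inj₂ Fx≡B′x) =
      Bx≢B′x (trans (sym (agreement⇒≡ {F} {B} (trans same (agreement-true {F} {B′} x-match Fx≡B′x)))) Fx≡B′x)

    agreement-≗ : ∀ {x} → F x ≢ B x → F x ≢ B′ x → (∀ {v} → v ≢ x → B′ v ≡ B v) →
                  agreement F B ≗ agreement F B′
    agreement-≗ {x} Fx≢Bx Fx≢B′x B′≡B-off v with v ≟ x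
    ... | yes refl = trans (agreement-false {F} {B} Fx≢Bx) (sym (agreement-false {F} {B′} Fx≢B′x))
    ... | no v≢x   = cong (λ z → matchB E v ∧ isYes (F v ≟ z)) (sym (B′≡B-off v≢x))

module Tournament {n : ℕ} {E : Digraph n} (T : IsSET E) where
  open IsSET T

  infix 4 _⟶_ _⊏_

  _⟶_ : Rel (Fin n) 0ℓ
  u ⟶ v = E u v ≡ true

  Players : Fin n → Pred (Fin n) 0ℓ
  Players v a = InP E a v

  walk-++ : ∀ {u v w} → Walk E u v → Walk E v w → Walk E u w
  walk-++ here       q = q
  walk-++ (step e p) q = step e (walk-++ p q)

  walk-snoc : ∀ {u v w} → Walk E u v → v ⟶ w → Walk E u w
  walk-snoc p e = walk-++ p (step e here)

  Players-extend : ∀ {a u v} → InP E a u → u ⟶ v → InP E a v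
  Players-extend (a-player , a⇝u) u⟶v = a-player , walk-snoc a⇝u u⟶v

  walk-to-source : ∀ {c a} → Walk E c a → IsSource E a → c ≡ a
  walk-to-source here           _        = refl
  walk-to-source (step c⟶w w⇝a) a-source with walk-to-source w⇝a a-source
  ... | refl = contradiction (a-source _) (not-¬ c⟶w)

  last-edge : ∀ {c v} → Walk E c v → c ≡ v ⊎ ∃ λ u → Walk E c u × u ⟶ v
  last-edge here = inj₁ refl
  last-edge (step c⟶w w⇝v) with last-edge w⇝v
  ... | inj₁ refl           = inj₂ (_ , here , c⟶w)
  ... | inj₂ (u , w⇝u , e) = inj₂ (u , step c⟶w w⇝u , e)

  out-unique : ∀ {u v w} → u ⟶ v → u ⟶ w → v ≡ w
  out-unique {u} {v} {w} u⟶v u⟶w with oneOut u (λ u-sink → not-¬ u⟶v (u-sink v))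
  ... | _ , _ , only = trans (only v u⟶v) (sym (only w u⟶w))

  _⊏_ : Rel (Fin n) 0ℓ
  u ⊏ v = ∃ λ w → u ⟶ w × Walk E w v

  ⊏-isStrictPartialOrder : IsStrictPartialOrder _≡_ _⊏_
  ⊏-isStrictPartialOrder = record
    { isEquivalence = isEquivalence
    ; irrefl        = λ { refl (_ , u⟶w , w⇝u) → acyclic _ _ u⟶w w⇝u }
    ; trans         = λ { (w , u⟶w , w⇝v) (_ , v⟶w′ , w′⇝z) → w , u⟶w , walk-++ w⇝v (step v⟶w′ w′⇝z) }
    ; <-resp-≈      = resp₂ _⊏_
    }

  ⟶-wellFounded : WellFounded _⟶_
  ⟶-wellFounded = Subrelation.wellFounded (λ u⟶v → _ , u⟶v , here) (spo-wellFounded ⊏-isStrictPartialOrder)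

  walk? : Decidable (Walk E)
  walk? c v = go c (spo-noetherian ⊏-isStrictPartialOrder c)
    where
    go : ∀ c → Acc (flip _⊏_) c → Dec (Walk E c v)
    go c (acc rs) with c ≟ v | any? (λ w → E c w Bool.≟ true)
    ... | yes refl | _                = yes here
    ... | no c≢v   | no stuck         = no λ { here → c≢v refl ; (step c⟶w _) → stuck (_ , c⟶w) }
    ... | no c≢v   | yes (w , c⟶w) = map′ (step c⟶w) beyond-w (go w (rs (w , c⟶w , here)))
      where
      beyond-w : Walk E c v → Walk E w v
      beyond-w here               = contradiction refl c≢v
      beyond-w (step c⟶w′ w′⇝v) = subst (λ z → Walk E z v) (out-unique c⟶w′ c⟶w) w′⇝v

  Players? : ∀ v → Decidable₁ (Players v)
  Players? v a = source? E a ×-dec walk? a v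

  opaque
    descend : ∀ {ℓ} {Q : Pred (Fin n) ℓ} → Decidable₁ Q → ∀ {v} → Q v →
              ∃ λ x → Q x × Walk E x v × (∀ {u} → u ⟶ x → ¬ Q u)
    descend {Q = Q} Q? {v} Qv = go v Qv (⟶-wellFounded v)
      where
      go : ∀ v → Q v → Acc _⟶_ v → ∃ λ x → Q x × Walk E x v × (∀ {u} → u ⟶ x → ¬ Q u)
      go v Qv (acc rs) with any? (λ u → (E u v Bool.≟ true) ×-dec Q? u)
      ... | no ¬lower = v , Qv , here , λ u⟶v Qu → ¬lower (_ , u⟶v , Qu)
      ... | yes (u , u⟶v , Qu) with go u Qu (rs u⟶v)
      ...   | x , Qx , x⇝u , minimal = x , Qx , walk-snoc x⇝u u⟶v , minimal

  Players-nonempty : ∀ v → ∃ (Players v)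
  Players-nonempty v with descend {Q = λ _ → ⊤} (λ _ → yes tt) {v} tt
  ... | x , _ , x⇝v , minimal = x , (λ u → ¬-not (λ u⟶x → minimal u⟶x tt)) , x⇝v

  walks-comparable : ∀ {c u v} → Walk E c u → Walk E c v → Walk E u v ⊎ Walk E v u
  walks-comparable here         c⇝v          = inj₁ c⇝v
  walks-comparable (step e p) here           = inj₂ (step e p)
  walks-comparable (step e p) (step e′ q) with out-unique e e′
  ... | refl = walks-comparable p q

  sibling-unreachable : ∀ {u v y} → u ⟶ y → v ⟶ y → u ≢ v → ¬ Walk E u v
  sibling-unreachable _   _   u≢v here             = u≢v refl
  sibling-unreachable u⟶y v⟶y _   (step u⟶w w⇝v) with out-unique u⟶w u⟶y
  ... | refl = acyclic _ _ v⟶y w⇝v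

  siblings-disjoint : ∀ {u v y c} → u ⟶ y → v ⟶ y → u ≢ v → Walk E c u → ¬ Walk E c v
  siblings-disjoint u⟶y v⟶y u≢v c⇝u c⇝v =
    [ sibling-unreachable u⟶y v⟶y u≢v , sibling-unreachable v⟶y u⟶y (u≢v ∘ sym) ]′ (walks-comparable c⇝u c⇝v)

  sibling : ∀ {x p} → x ⟶ p → ∃ λ w → w ⟶ p × w ≢ x
  sibling {x} {p} x⟶p with any? (λ w → (E w p Bool.≟ true) ×-dec ¬? (w ≟ x))
  ... | yes found = found
  ... | no none   = contradiction (x , x⟶p , only-x) (inDegNotOne p)
    where
    only-x : ∀ w → w ⟶ p → w ≡ x
    only-x w w⟶p = decidable-stable (w ≟ x) (λ w≢x → none (w , w⟶p , w≢x))

  module _ {B : Fin n → Fin n} (bracket : IsBracket E B) where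
    open IsBracket bracket

    bracket-∈-Players : ∀ v → InP E (B v) v
    bracket-∈-Players v with descend (λ u → B u ≟ B v) {v} refl
    ... | x , Bx≡Bv , x⇝v , minimal with source? E x
    ...   | yes x-player = subst (λ a → InP E a v) (trans (sym (onPlayer x x-player)) Bx≡Bv) (x-player , x⇝v)
    ...   | no x-match with onMatch x x-match
    ...     | u , u⟶x , Bx≡Bu = contradiction (trans (sym Bx≡Bu) Bx≡Bv) (minimal u⟶x)

    updateAt-isBracket : ∀ {u x} → u ⟶ x → (∀ {v} → x ⟶ v → ∃ λ w → w ⟶ v × w ≢ x × B w ≡ B v) →
                         IsBracket E (updateAt B x (const (B u)))
    updateAt-isBracket {u} {x} u⟶x bypass = record
      { toPlayer = toPlayer′ ; onPlayer = onPlayer′ ; onMatch = onMatch′ }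
      where
      B′ = updateAt B x (const (B u))

      at-x : B′ x ≡ B u
      at-x = updateAt-updates x B

      off-x : ∀ {v} → v ≢ x → B′ v ≡ B v
      off-x v≢x = updateAt-minimal _ x B v≢x

      u≢x : u ≢ x
      u≢x refl = acyclic _ _ u⟶x here

      toPlayer′ : ∀ v → IsPlayer E (B′ v)
      toPlayer′ v with v ≟ x
      ... | yes refl = subst (IsPlayer E) (sym at-x) (toPlayer u)
      ... | no v≢x   = subst (IsPlayer E) (sym (off-x v≢x)) (toPlayer v)

      onPlayer′ : ∀ a → IsPlayer E a → B′ a ≡ a
      onPlayer′ a a-player = trans (off-x λ { refl → not-¬ u⟶x (a-player u) }) (onPlayer a a-player)

      onMatch′ : ∀ v → IsMatch E v → ∃ λ w → w ⟶ v × B′ v ≡ B′ w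
      onMatch′ v v-match with v ≟ x | E x v Bool.≟ true
      ... | yes refl | _ = u , u⟶x , trans at-x (sym (off-x u≢x))
      ... | no v≢x | yes x⟶v with bypass x⟶v
      ...   | w , w⟶v , w≢x , Bw≡Bv = w , w⟶v , trans (off-x v≢x) (trans (sym Bw≡Bv) (sym (off-x w≢x)))
      onMatch′ v v-match | no v≢x | no ¬x⟶v with onMatch v v-match
      ...   | w , w⟶v , Bv≡Bw = w , w⟶v , trans (off-x v≢x) (trans Bv≡Bw (sym (off-x λ { refl → ¬x⟶v w⟶v })))

  module Seeding (κ : Fin n → ℕ) (κ-injective : Injective _≡_ _≡_ κ) where

    private
      best : ∀ v → ∃ (Least κ (Players v))
      best v = ∃-least κ (Players? v) (Players-nonempty v)

    seeded : Fin n → Fin n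
    seeded v = proj₁ (best v)

    seeded-≡ : ∀ {v c} → Least κ (Players v) c → seeded v ≡ c
    seeded-≡ {v} = Least-unique κ-injective (proj₂ (best v))

    seeded-isBracket : IsBracket E seeded
    seeded-isBracket = record { toPlayer = λ v → proj₁ (∈-Players v) ; onPlayer = onPlayer ; onMatch = onMatch }
      where
      ∈-Players : ∀ v → InP E (seeded v) v
      ∈-Players v = proj₁ (proj₂ (best v))

      onPlayer : ∀ a → IsPlayer E a → seeded a ≡ a
      onPlayer a a-player = walk-to-source (proj₂ (∈-Players a)) a-player

      onMatch : ∀ x → IsMatch E x → ∃ λ u → u ⟶ x × seeded x ≡ seeded u
      onMatch x x-match with ∈-Players x
      ... | s-player , s⇝x with last-edge s⇝x
      ...   | inj₁ s≡x = contradiction (subst (IsPlayer E) s≡x s-player) x-match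
      ...   | inj₂ (u , s⇝u , u⟶x) =
        u , u⟶x , sym (seeded-≡ ((s-player , s⇝u) , λ d∈u → proj₂ (proj₂ (best x)) (Players-extend d∈u u⟶x)))

  promote : Fin n → (Fin n → ℕ) → Fin n → ℕ
  promote c κ v with v ≟ c
  ... | yes _ = 0
  ... | no _  = suc (κ v)

  promote-injective : ∀ {c κ} → Injective _≡_ _≡_ κ → Injective _≡_ _≡_ (promote c κ)
  promote-injective {c} κ-injective {u} {v} eq with u ≟ c | v ≟ c
  ... | yes refl | yes refl = refl
  ... | yes _    | no _     = contradiction eq 0≢1+n
  ... | no _     | yes _    = contradiction (sym eq) 0≢1+n
  ... | no _     | no _     = κ-injective (suc-injective eq)

  module _ {ℓ} {S : Pred (Fin n) ℓ} {c : Fin n} {κ : Fin n → ℕ} where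

    promote-least : S c → Least (promote c κ) S c
    promote-least c∈S = c∈S , λ {d} _ → subst (_≤ promote c κ d) (sym promote-self) z≤n
      where
      promote-self : promote c κ c ≡ 0
      promote-self with c ≟ c
      ... | yes _  = refl
      ... | no c≢c = contradiction refl c≢c

    promote-preserves-least : ¬ S c → ∀ {d} → Least κ S d → Least (promote c κ) S d
    promote-preserves-least c∉S {d} (d∈S , d-least) = d∈S , λ e∈S → shifted d∈S e∈S (d-least e∈S)
      where
      shifted : ∀ {u v} → S u → S v → κ u ≤ κ v → promote c κ u ≤ promote c κ v
      shifted {u} {v} u∈S v∈S κu≤κv with u ≟ c | v ≟ c
      ... | yes refl | _        = contradiction u∈S c∉S
      ... | _        | yes refl = contradiction v∈S c∉S
      ... | no _     | no _     = s≤s κu≤κv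

  rival : ∀ x a → ∃ λ c → (InP E c x → c ≡ a) × (∀ {v} → x ⟶ v → ∃ λ w → w ⟶ v × w ≢ x × InP E c w)
  rival x a with any? (λ p → E x p Bool.≟ true)
  ... | no x-final = a , const refl , λ x⟶v → contradiction (_ , x⟶v) x-final
  ... | yes (p , x⟶p) with sibling x⟶p
  ...   | w , w⟶p , w≢x with Players-nonempty w
  ...     | c , c∈w = c , c∈x⇒c≡a , beside
    where
    c∈x⇒c≡a : InP E c x → c ≡ a
    c∈x⇒c≡a (_ , c⇝x) = contradiction (proj₂ c∈w) (siblings-disjoint x⟶p w⟶p (w≢x ∘ sym) c⇝x)

    beside : ∀ {v} → x ⟶ v → ∃ λ w′ → w′ ⟶ v × w′ ≢ x × InP E c w′
    beside x⟶v with out-unique x⟶p x⟶v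
    ... | refl = w , w⟶p , w≢x , c∈w

  brackets-differing-only-at : ∀ {x a b} → IsXab E x a b →
            ∃₂ λ B B′ → IsBracket E B × IsBracket E B′ × B x ≡ a × B′ x ≡ b × (∀ {v} → v ≢ x → B′ v ≡ B v)
  brackets-differing-only-at {x} {a} {b} (_ , ua , ub , ua⟶x , ub⟶x , a∈ua , _ , b∈ub , a∉ub) with rival x a
  ... | c , c∈x⇒c≡a , c-beside =
    B , B′ , seeded-isBracket , updateAt-isBracket seeded-isBracket ub⟶x bypass ,
    seeded-≡ a-least , trans (updateAt-updates x B) (seeded-≡ b-least) , λ v≢x → updateAt-minimal _ x B v≢x
    where
    open Seeding (promote c (promote a (promote b toℕ)))
                 (promote-injective (promote-injective (promote-injective toℕ-injective)))

    B  = seeded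
    B′ = updateAt B x (const (B ub))

    a-least : Least _ (Players x) a
    a-least with c ≟ a
    ... | yes refl = promote-least (Players-extend a∈ua ua⟶x)
    ... | no c≢a   = promote-preserves-least (c≢a ∘ c∈x⇒c≡a) (promote-least (Players-extend a∈ua ua⟶x))

    c∉ub : ¬ InP E c ub
    c∉ub c∈ub = a∉ub (subst (λ z → InP E z ub) (c∈x⇒c≡a (Players-extend c∈ub ub⟶x)) c∈ub)

    b-least : Least _ (Players ub) b
    b-least = promote-preserves-least c∉ub (promote-preserves-least a∉ub (promote-least b∈ub))

    bypass : ∀ {v} → x ⟶ v → ∃ λ w → w ⟶ v × w ≢ x × B w ≡ B v
    bypass x⟶v with c-beside x⟶v
    ... | w , w⟶v , w≢x , c∈w =
      w , w⟶v , w≢x ,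
      trans (seeded-≡ (promote-least c∈w)) (sym (seeded-≡ (promote-least (Players-extend c∈w w⟶v))))

  lowest-disagreement-isXab : ∀ {B B′ x} → IsBracket E B → IsBracket E B′ → B x ≢ B′ x →
                              (∀ {u} → u ⟶ x → B u ≡ B′ u) → IsXab E x (B x) (B′ x)
  lowest-disagreement-isXab {B} {B′} {x} bracket bracket′ Bx≢B′x agree-below =
    from-feeders (IsBracket.onMatch bracket x x-match) (IsBracket.onMatch bracket′ x x-match)
    where
    x-match : IsMatch E x
    x-match x-player =
      Bx≢B′x (trans (IsBracket.onPlayer bracket x x-player) (sym (IsBracket.onPlayer bracket′ x x-player)))

    from-feeders : (∃ λ u → u ⟶ x × B x ≡ B u) → (∃ λ u′ → u′ ⟶ x × B′ x ≡ B′ u′) → IsXab E x (B x) (B′ x)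
    from-feeders (u , u⟶x , Bx≡Bu) (u′ , u′⟶x , B′x≡B′u′) =
      x-match , u , u′ , u⟶x , u′⟶x , a∈u ,
      (λ (_ , b⇝u) → siblings-disjoint u′⟶x u⟶x (u≢u′ ∘ sym) (proj₂ b∈u′) b⇝u) , b∈u′ ,
      (λ (_ , a⇝u′) → siblings-disjoint u⟶x u′⟶x u≢u′ (proj₂ a∈u) a⇝u′)
      where
      u≢u′ : u ≢ u′
      u≢u′ refl = Bx≢B′x (trans Bx≡Bu (trans (agree-below u⟶x) (sym B′x≡B′u′)))

      a∈u : InP E (B x) u
      a∈u = subst (λ z → InP E z u) (sym Bx≡Bu) (bracket-∈-Players bracket u)

      b∈u′ : InP E (B′ x) u′
      b∈u′ = subst (λ z → InP E z u′) (sym B′x≡B′u′) (bracket-∈-Players bracket′ u′)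

  disagreement-site : ∀ {B B′} → IsBracket E B → IsBracket E B′ → Distinct E B B′ →
                      ∃ λ x → B x ≢ B′ x × IsXab E x (B x) (B′ x)
  disagreement-site {B} {B′} bracket bracket′ B≠B′ with ¬∀⟶∃¬ n _ (λ v → B v ≟ B′ v) B≠B′
  ... | v , Bv≢B′v with descend (λ u → ¬? (B u ≟ B′ u)) Bv≢B′v
  ...   | x , Bx≢B′x , _ , minimal =
    x , Bx≢B′x ,
    lowest-disagreement-isXab bracket bracket′ Bx≢B′x (λ {u} u⟶x → decidable-stable (B u ≟ B′ u) (minimal u⟶x))

  module Resolution {N : ℕ} (brackets : HasCount E (IsBracket E) N) (M : CommutativeMonoid 0ℓ 0ℓ)
                    {σ : Fin n → CommutativeMonoid.Carrier M} (dss : Scoring.DistinctSubsetSums E M σ)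
                    {m : ℕ} (min-pair : IsMinPairCount E m) where
    open Scoring E M
    open Counting E
    open Agreement E M

    PairWin : Fin n → Fin n → Fin n → (Fin n → Fin n) → Set
    PairWin x a b B = B x ≡ a ⊎ B x ≡ b

    pair-split : ∀ x a b → ∃₂ λ c c′ → c + c′ ≡ N × PairCount E x a b c ×
                                       HasCount E (λ B → IsBracket E B × ¬ PairWin x a b B) c′
    pair-split x a b = count-split brackets (λ B → (B x ≟ a) ⊎-dec (B x ≟ b))
      (λ B≗B′ → Data.Sum.map (trans (sym (B≗B′ x))) (trans (sym (B≗B′ x))))

    pair-avoiders-unresolving : ∀ {x a b r} → IsXab E x a b → a ≢ b →
                                DistinctFamily (λ B → IsBracket E B × ¬ PairWin x a b B) r → ¬ AllResolving σ r
    pair-avoiders-unresolving xab a≢b (f , f-ok , f-distinct) resolving with brackets-differing-only-at xab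
    ... | B , B′ , bracket , bracket′ , Bx≡a , B′x≡b , B′≡B-off
        with resolving f (proj₁ ∘ f-ok , f-distinct) B B′ bracket bracket′
             (λ B≗B′ → a≢b (trans (sym Bx≡a) (trans (B≗B′ _) B′x≡b)))
    ...   | i , resolved = resolved (score-cong (agreement-≗ {f i} {B} {B′} Fx≢Bx Fx≢B′x B′≡B-off))
      where
      Fx≢Bx  = λ eq → proj₂ (f-ok i) (inj₁ (trans eq Bx≡a))
      Fx≢B′x = λ eq → proj₂ (f-ok i) (inj₂ (trans eq B′x≡b))

    res-allResolving : AllResolving σ (N + 1 ∸ m)
    res-allResolving f (f-brackets , f-distinct) B B′ bracket bracket′ B≠B′
      with any? (λ i → ¬? (agreement-≗? (f i) B B′))
    ... | yes (i , sets-differ) = i , sets-differ ∘ score-injective dss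
    ... | no ¬differ with disagreement-site bracket bracket′ B≠B′
    ...   | x , Bx≢B′x , xab with pair-split x (B x) (B′ x)
    ...     | c , c′ , c+c′≡N , pairs , others = contradiction (≤-trans res>c′ res≤c′) (<-irrefl refl)
      where
      avoids : ∀ i → ¬ PairWin x (B x) (B′ x) (f i)
      avoids i = avoids-pair {f i} {B} {B′} (proj₁ xab) Bx≢B′x
        (decidable-stable (agreement-≗? (f i) B B′) (λ ¬same → ¬differ (i , ¬same)) x)

      res≤c′ : N + 1 ∸ m ≤ c′
      res≤c′ = family-≤-count {Q = λ F → IsBracket E F × ¬ PairWin x (B x) (B′ x) F}
                               (f , (λ i → f-brackets i , avoids i) , f-distinct) others

      m≤c : m ≤ c
      m≤c = proj₂ min-pair _ _ x c (IsBracket.toPlayer bracket x) (IsBracket.toPlayer bracket′ x)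
                               Bx≢B′x xab pairs

      res>c′ : suc c′ ≤ N + 1 ∸ m
      res>c′ = ≤-trans (≤-reflexive (sym (∸-complement c+c′≡N))) (∸-monoʳ-≤ (N + 1) m≤c)

    allResolving⇒res≤ : ∀ r → AllResolving σ r → N + 1 ∸ m ≤ r
    allResolving⇒res≤ r resolving with N + 1 ∸ m ≤? r | proj₁ min-pair
    ... | yes res≤r | _ = res≤r
    ... | no res≰r | a , b , x , _ , _ , a≢b , xab , pairs-m with pair-split x a b
    ...   | c , c′ , c+c′≡N , pairs , others =
      contradiction resolving
        (pair-avoiders-unresolving xab a≢b (subfamily {Q = Avoider} (count-family others) r≤c′))
      where
      Avoider = λ F → IsBracket E F × ¬ PairWin x a b F

      m+c′≡N : m + c′ ≡ N
      m+c′≡N = subst (λ k → k + c′ ≡ N) (count-unique pairs pairs-m) c+c′≡N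

      r≤c′ : r ≤ c′
      r≤c′ = ≤-pred (subst (r <_) (∸-complement m+c′≡N) (≰⇒> res≰r))

lemmaA2 : (n : ℕ) (E : Digraph n) → IsSET E →
    (Σ (Fin n) λ a → Σ (Fin n) λ b → IsPlayer E a × IsPlayer E b × a ≢ b) →
    (N : ℕ) → HasCount E (IsBracket E) N →
    (M : CommutativeMonoid 0ℓ 0ℓ) →
    (_<_ : CommutativeMonoid.Carrier M → CommutativeMonoid.Carrier M → Set) →
    (σ : Fin n → CommutativeMonoid.Carrier M) →
    (∀ x → IsMatch E x → CommutativeMonoid.ε M < σ x) →
    Scoring.DistinctSubsetSums E M σ →
    (m : ℕ) → IsMinPairCount E m →
    Scoring.IsRes E M σ (N + 1 ∸ m)
lemmaA2 n E T _ N brackets M _ σ _ dss m min-pair = res-allResolving , allResolving⇒res≤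
  where open Tournament.Resolution T brackets M dss min-pair
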